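{- Let $g,m$ be positive integers with $g\ne1$, and put $h=2\left(\frac{m/g-1}{g-1}+1\right)$. Then $h>0$ and $\frac12\bigl(g^2(h-2)-g(h-4)\bigr)=m$, so that $m=P^h_g$ whenever $h$ is an integer (then $h\ge1$). This happens in the following cases: (i) (trivial cases) $m=g\ge2$ if and only if $h=2$; and for $m\ge1$: $g=2$ if and only if $h=m$. (ii) If $m>g\ge2$, $g\mid m$ and $g-1\mid m-1$, then $h$ is an even integer with $h\ge4$. Moreover, $h$ is an even integer in the following derived cases: (iii) If $g\mid m$ and $s_g(m)=g$, then $h\ge6$. (iv) If $m\in\mathcal S$ and $g$ is a factor of a strict $s$-decomposition of $m$, then $h\ge6$. (v) If $m$ is a Carmichael number and $g$ is a prime divisor of $m$, then $h\ge6$. (vi) Let $n\ge3$ and let $U_n(t)=\prod_{\nu=1}^n g_\nu$ with $g_\nu=a_\nu t+b_\nu$ be a universal form. For a fixed $\nu$ and integer $t\ge0$, if $m=U_n(t)$ and $g=g_\nu$ satisfy $m>g>1$, then $h\ge4$.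
   Context: For integers $h\ge1$ and $n\ge1$, $P^h_n=\frac12\bigl(n^2(h-2)-n(h-4)\bigr)$ is the $h$-gonal number. For an integer base $g\ge2$ and $m\ge0$, $s_g(m)$ is the sum of base-$g$ digits of $m$. A strict $s$-decomposition of a positive integer $m$ is a factorization $m=\prod_{\nu=1}^n g_\nu^{e_\nu}$, $e_\nu\ge1$, with proper factors $1<g_\nu<m$, $g_1<\dots<g_n$ (not necessarily coprime), and $s_{g_\nu}(m)=g_\nu$ for all $\nu$; $\mathcal S$ is the set of positive integers admitting one. A Carmichael number is a composite positive $m$ with $a^{m-1}\equiv1\pmod m$ for all $a$ coprime to $m$. A universal form is a squarefree polynomial $U_n(t)=\prod_{\nu=1}^n(a_\nu t+b_\nu)\in\mathbb Z[t]$ ($n\ge3$) with positive integer coefficients $a_\nu,b_\nu$ such that $U_n(t)\equiv1\pmod{a_\nu t+b_\nu-1}$ for all $1\le\nu\le n$ and all integers $t\ge0$, except for the cases $t=0$ and $b_\nu=1$. -}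

module Defs where

open import Data.Nat as ℕ using (ℕ; zero; suc; _∸_; _<_; _≤_; _^_)
open import Data.Nat.DivMod using (_%_; _/_)
open import Data.Nat.Divisibility using (_∣_)
open import Data.Nat.Coprimality using (Coprime)
open import Data.Nat.Primality using (Composite)
open import Data.Integer as ℤ using (ℤ; +_)
import Data.Integer.Divisibility as ℤDiv
open import Data.Rational as ℚ using (ℚ; 0ℚ; 1ℚ)
open import Data.List using (List; map; tabulate)
open import Data.Nat.ListAction using (product)
open import Data.List.Relation.Unary.All using (All)
open import Data.List.Relation.Unary.Linked using (Linked)
open import Data.Fin using (Fin)
open import Data.Product using (_×_; _,_; proj₁; Σ; ∃)
open import Relation.Binary.PropositionalEquality using (_≡_; _≢_)
open import Relation.Nullary using (¬_)

ℤtoℚ : ℤ → ℚ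
ℤtoℚ z = z ℚ./ 1

-- h = 2 ( (m/g - 1)/(g - 1) + 1 ), as a rational number.
-- Only meaningful for g ≥ 2 (every use assumes 2 ≤ g); junk value 0 otherwise.
hVal : ℕ → ℕ → ℚ
hVal (suc (suc k)) m =
  let g = suc (suc k) in
  (+ 2 ℚ./ 1) ℚ.* ((((+ m ℚ./ g) ℚ.- 1ℚ) ℚ.* (+ 1 ℚ./ (g ∸ 1))) ℚ.+ 1ℚ)
hVal _ _ = 0ℚ

Polygonal : ℤ → ℕ → ℤ
Polygonal h n = ((+ n ℤ.* + n) ℤ.* (h ℤ.- + 2) ℤ.- + n ℤ.* (h ℤ.- + 4)) ℤ./ℕ 2

EvenIntAtLeast : ℤ → ℚ → Set
EvenIntAtLeast lb q = Σ ℤ λ H → (q ≡ ℤtoℚ H) × (+ 2 ℤDiv.∣ H) × (lb ℤ.≤ H)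

IntAtLeast : ℤ → ℚ → Set
IntAtLeast lb q = Σ ℤ λ H → (q ≡ ℤtoℚ H) × (lb ℤ.≤ H)

-- Sum of base-g digits of m (g ≥ 2; junk 0 otherwise). Repeatedly take
-- n % g and continue with n / g; the fuel m suffices since n / g < n for n > 0.
digitSumAux : (g : ℕ) → .{{_ : ℕ.NonZero g}} → ℕ → ℕ → ℕ
digitSumAux g zero    n = 0
digitSumAux g (suc f) n = n % g ℕ.+ digitSumAux g f (n / g)

digitSum : ℕ → ℕ → ℕ
digitSum (suc (suc k)) m = digitSumAux (suc (suc k)) m m
digitSum _ _ = 0

StrictSDecomp : ℕ → List (ℕ × ℕ) → Set
StrictSDecomp m d =
  Linked (λ p q → proj₁ p < proj₁ q) d
  × All (λ p → (1 ≤ Data.Product.proj₂ p) × (1 < proj₁ p) × (proj₁ p < m)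
               × (digitSum (proj₁ p) m ≡ proj₁ p)) d
  × (product (map (λ p → proj₁ p ^ Data.Product.proj₂ p) d) ≡ m)

InS : ℕ → Set
InS m = ∃ λ d → StrictSDecomp m d

Carmichael : ℕ → Set
Carmichael m = Composite m
  × (∀ (a : ℤ) → Coprime ℤ.∣ a ∣ m → + m ℤDiv.∣ (a ℤ.^ (m ∸ 1) ℤ.- + 1))

linFactor : ∀ {n} → (Fin n → ℕ) → (Fin n → ℕ) → Fin n → ℕ → ℕ
linFactor a b ν t = a ν ℕ.* t ℕ.+ b ν

Uform : ∀ {n} → (Fin n → ℕ) → (Fin n → ℕ) → ℕ → ℕ
Uform {n} a b t = product (tabulate {n = n} (λ ν → linFactor a b ν t))

-- Squarefreeness of ∏ (a_ν t + b_ν) (positive coefficients): no two factors share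
-- a root, i.e. the factors are pairwise non-proportional.
SquarefreeProd : ∀ {n} → (Fin n → ℕ) → (Fin n → ℕ) → Set
SquarefreeProd a b = ∀ μ ν → μ ≢ ν → a μ ℕ.* b ν ≢ a ν ℕ.* b μ

UniversalForm : (n : ℕ) → (Fin n → ℕ) → (Fin n → ℕ) → Set
UniversalForm n a b =
  (3 ≤ n)
  × (∀ ν → 1 ≤ a ν) × (∀ ν → 1 ≤ b ν)
  × SquarefreeProd a b
  × (∀ ν (t : ℕ) → ¬ ((t ≡ 0) × (b ν ≡ 1))
       → (+ (linFactor a b ν t) ℤ.- + 1) ℤDiv.∣ (+ (Uform a b t) ℤ.- + 1))

{-# OPTIONS --safe #-}
-- Clearing denominators, h g (g - 1) = 2 (m + g (g - 2)); this gives h > 0, the polygonal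
-- identity and the trivial cases at once. If g ∣ m and g - 1 ∣ m - 1, the cofactor x = m / g
-- satisfies x ≡ 1 (mod g - 1), say x = 1 + c (g - 1), and then h = 2 (1 + c). Here c = 0 and c = 1
-- mean m = g and m = g², so h ≥ 4 when m > g and h ≥ 6 when moreover m ≠ g².
-- The derived cases supply these hypotheses: s_g(m) ≡ m (mod g - 1) while s_g(1) = s_g(g) = 1 ≠ g;
-- a universal form has the congruence built in; and a prime p dividing a Carmichael number m
-- satisfies Korselt's criterion p² ∤ m, p - 1 ∣ m - 1. For the latter, if e = (m - 1) mod (p - 1)
-- were positive, every unit modulo p would be a root of X^e - 1 (by Fermat's little theorem and
-- a Chinese-remainder lift to a unit modulo m), contradicting Lagrange's bound on the number of roots.
module Submission where

open import Defs

module Parameter where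

  open import Data.Nat as ℕ using (ℕ; suc; _≤_; _∸_; s≤s; z≤n)
  import Data.Nat.Properties as ℕ
  open import Data.Integer as ℤ using (ℤ; +_)
  import Data.Integer.Properties as ℤ
  open import Data.Rational as ℚ using (ℚ; 0ℚ; 1ℚ; ½; _+_; _*_; _-_; _/_; toℚᵘ)
  import Data.Rational.Properties as ℚ
  import Data.Rational.Unnormalised as ℚᵘ
  import Data.Rational.Unnormalised.Properties as ℚᵘ
  open import Data.Rational.Solver using (module +-*-Solver)
  import Data.Integer.Tactic.RingSolver as ℤ-Ring
  open import Function.Bundles using (_⇔_; mk⇔; Equivalence)
  open import Relation.Binary.PropositionalEquality

  private
    toℚᵘ-/ : ∀ z n → toℚᵘ (z / suc n) ℚᵘ.≃ ℚᵘ.mkℚᵘ z n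
    toℚᵘ-/ z n = ℚ.toℚᵘ-fromℚᵘ (ℚᵘ.mkℚᵘ z n)

  ℤtoℚ-+ : ∀ a b → ℤtoℚ (a ℤ.+ b) ≡ ℤtoℚ a + ℤtoℚ b
  ℤtoℚ-+ a b = ℚ.toℚᵘ-injective (begin
    toℚᵘ (ℤtoℚ (a ℤ.+ b))                      ≈⟨ toℚᵘ-/ (a ℤ.+ b) 0 ⟩
    ℚᵘ.mkℚᵘ (a ℤ.+ b) 0                        ≈⟨ ℚᵘ.*≡* (cross a b) ⟩
    ℚᵘ.mkℚᵘ a 0 ℚᵘ.+ ℚᵘ.mkℚᵘ b 0                ≈⟨ ℚᵘ.+-cong (toℚᵘ-/ a 0) (toℚᵘ-/ b 0) ⟨
    toℚᵘ (ℤtoℚ a) ℚᵘ.+ toℚᵘ (ℤtoℚ b)            ≈⟨ ℚ.toℚᵘ-homo-+ (ℤtoℚ a) (ℤtoℚ b) ⟨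
    toℚᵘ (ℤtoℚ a + ℤtoℚ b)                      ∎)
    where
    open ℚᵘ.≃-Reasoning
    cross : ∀ a b → (a ℤ.+ b) ℤ.* + 1 ≡ (a ℤ.* + 1 ℤ.+ b ℤ.* + 1) ℤ.* + 1
    cross = ℤ-Ring.solve-∀

  ℤtoℚ-* : ∀ a b → ℤtoℚ (a ℤ.* b) ≡ ℤtoℚ a * ℤtoℚ b
  ℤtoℚ-* a b = ℚ.toℚᵘ-injective (begin
    toℚᵘ (ℤtoℚ (a ℤ.* b))                      ≈⟨ toℚᵘ-/ (a ℤ.* b) 0 ⟩
    ℚᵘ.mkℚᵘ (a ℤ.* b) 0                        ≈⟨ ℚᵘ.*-cong (toℚᵘ-/ a 0) (toℚᵘ-/ b 0) ⟨
    toℚᵘ (ℤtoℚ a) ℚᵘ.* toℚᵘ (ℤtoℚ b)            ≈⟨ ℚ.toℚᵘ-homo-* (ℤtoℚ a) (ℤtoℚ b) ⟨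
    toℚᵘ (ℤtoℚ a * ℤtoℚ b)                      ∎)
    where open ℚᵘ.≃-Reasoning

  ℤtoℚ-injective : ∀ {a b} → ℤtoℚ a ≡ ℤtoℚ b → a ≡ b
  ℤtoℚ-injective {a} {b} eq with ℚᵘ.≃-trans (ℚᵘ.≃-sym (toℚᵘ-/ a 0)) (ℚᵘ.≃-trans (ℚ.toℚᵘ-cong eq) (toℚᵘ-/ b 0))
  ... | ℚᵘ.*≡* cross = trans (sym (ℤ.*-identityʳ a)) (trans cross (ℤ.*-identityʳ b))

  /-*-cancel : ∀ z n → (z / suc n) * ℤtoℚ (+ suc n) ≡ ℤtoℚ z
  /-*-cancel z n = ℚ.toℚᵘ-injective (begin
    toℚᵘ ((z / suc n) * ℤtoℚ (+ suc n))                  ≈⟨ ℚ.toℚᵘ-homo-* (z / suc n) (ℤtoℚ (+ suc n)) ⟩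
    toℚᵘ (z / suc n) ℚᵘ.* toℚᵘ (ℤtoℚ (+ suc n))          ≈⟨ ℚᵘ.*-cong (toℚᵘ-/ z n) (toℚᵘ-/ (+ suc n) 0) ⟩
    ℚᵘ.mkℚᵘ z n ℚᵘ.* ℚᵘ.mkℚᵘ (+ suc n) 0                  ≈⟨ ℚᵘ.*≡* cross ⟩
    ℚᵘ.mkℚᵘ z 0                                          ≈⟨ toℚᵘ-/ z 0 ⟨
    toℚᵘ (ℤtoℚ z)                                        ∎)
    where
    open ℚᵘ.≃-Reasoning
    cross : (z ℤ.* + suc n) ℤ.* + 1 ≡ z ℤ.* + (suc n ℕ.* 1)
    cross = trans (ℤ.*-identityʳ (z ℤ.* + suc n)) (cong (λ d → z ℤ.* + d) (sym (ℕ.*-identityʳ (suc n))))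

  -- Y, V and K stand for m / g, 1 / (g - 1) and g - 2.
  clear-denominators : ∀ A Y V K → Y * (+ 2 / 1 + K) ≡ A → V * (1ℚ + K) ≡ 1ℚ →
    + 2 / 1 * ((Y - 1ℚ) * V + 1ℚ) * ((+ 2 / 1 + K) * (1ℚ + K)) ≡ + 2 / 1 * (A + (+ 2 / 1 + K) * K)
  clear-denominators A Y V K Y*g≡A V*[g-1]≡1 = begin
    + 2 / 1 * ((Y - 1ℚ) * V + 1ℚ) * ((+ 2 / 1 + K) * (1ℚ + K))
      ≡⟨ solve 3 (λ Y V K → con (+ 2 / 1) :* ((Y :- con 1ℚ) :* V :+ con 1ℚ) :* ((con (+ 2 / 1) :+ K) :* (con 1ℚ :+ K))
         := con (+ 2 / 1) :* ((Y :* (con (+ 2 / 1) :+ K) :- (con (+ 2 / 1) :+ K)) :* (V :* (con 1ℚ :+ K))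
                             :+ (con (+ 2 / 1) :+ K) :* (con 1ℚ :+ K))) refl Y V K ⟩
    + 2 / 1 * ((Y * (+ 2 / 1 + K) - (+ 2 / 1 + K)) * (V * (1ℚ + K)) + (+ 2 / 1 + K) * (1ℚ + K))
      ≡⟨ cong₂ (λ a v → + 2 / 1 * ((a - (+ 2 / 1 + K)) * v + (+ 2 / 1 + K) * (1ℚ + K))) Y*g≡A V*[g-1]≡1 ⟩
    + 2 / 1 * ((A - (+ 2 / 1 + K)) * 1ℚ + (+ 2 / 1 + K) * (1ℚ + K))
      ≡⟨ solve 2 (λ A K → con (+ 2 / 1) :* ((A :- (con (+ 2 / 1) :+ K)) :* con 1ℚ :+ (con (+ 2 / 1) :+ K) :* (con 1ℚ :+ K))
         := con (+ 2 / 1) :* (A :+ (con (+ 2 / 1) :+ K) :* K)) refl A K ⟩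
    + 2 / 1 * (A + (+ 2 / 1 + K) * K) ∎
    where
    open ≡-Reasoning
    open +-*-Solver

  ℤtoℚ-pos-* : ∀ a b → ℤtoℚ (+ (a ℕ.* b)) ≡ ℤtoℚ (+ a) * ℤtoℚ (+ b)
  ℤtoℚ-pos-* a b = trans (cong ℤtoℚ (ℤ.pos-* a b)) (ℤtoℚ-* (+ a) (+ b))

  hVal-equation : ∀ k m → let K = ℤtoℚ (+ k) in
    hVal (2 ℕ.+ k) m * ((+ 2 / 1 + K) * (1ℚ + K)) ≡ + 2 / 1 * (ℤtoℚ (+ m) + (+ 2 / 1 + K) * K)
  hVal-equation k m = clear-denominators (ℤtoℚ (+ m)) (+ m / suc (suc k)) (+ 1 / suc k) (ℤtoℚ (+ k))
    (trans (cong (+ m / suc (suc k) *_) (sym (ℤtoℚ-+ (+ 2) (+ k)))) (/-*-cancel (+ m) (suc k)))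
    (trans (cong (+ 1 / suc k *_) (sym (ℤtoℚ-+ (+ 1) (+ k)))) (/-*-cancel (+ 1) k))

  hVal*g[g∸1]≡2[m+g[g∸2]] : ∀ {g} m → 2 ≤ g →
    hVal g m * ℤtoℚ (+ (g ℕ.* (g ∸ 1))) ≡ ℤtoℚ (+ (2 ℕ.* (m ℕ.+ g ℕ.* (g ∸ 2))))
  hVal*g[g∸1]≡2[m+g[g∸2]] {suc (suc k)} m (s≤s (s≤s z≤n)) = begin
    hVal g m * ℤtoℚ (+ (g ℕ.* suc k))      ≡⟨ cong (hVal g m *_) G≡ ⟩
    hVal g m * ((+ 2 / 1 + K) * (1ℚ + K))  ≡⟨ hVal-equation k m ⟩
    + 2 / 1 * (A + (+ 2 / 1 + K) * K)      ≡⟨ N≡ ⟨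
    ℤtoℚ (+ (2 ℕ.* (m ℕ.+ g ℕ.* k)))       ∎
    where
    open ≡-Reasoning
    g : ℕ
    g = suc (suc k)
    A K : ℚ
    A = ℤtoℚ (+ m)
    K = ℤtoℚ (+ k)
    g≡2+K : ℤtoℚ (+ g) ≡ + 2 / 1 + K
    g≡2+K = ℤtoℚ-+ (+ 2) (+ k)
    G≡ : ℤtoℚ (+ (g ℕ.* suc k)) ≡ (+ 2 / 1 + K) * (1ℚ + K)
    G≡ = trans (ℤtoℚ-pos-* g (suc k)) (cong₂ _*_ g≡2+K (ℤtoℚ-+ (+ 1) (+ k)))
    N≡ : ℤtoℚ (+ (2 ℕ.* (m ℕ.+ g ℕ.* k))) ≡ + 2 / 1 * (A + (+ 2 / 1 + K) * K)
    N≡ = trans (ℤtoℚ-pos-* 2 (m ℕ.+ g ℕ.* k)) (cong (+ 2 / 1 *_)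
           (trans (ℤtoℚ-+ (+ m) (+ (g ℕ.* k))) (cong (λ x → A + x) (trans (ℤtoℚ-pos-* g k) (cong (_* K) g≡2+K)))))

  ½[g²[h-2]-g[h-4]]≡m : ∀ {g} m → 2 ≤ g →
    ½ * (((+ g / 1) * (+ g / 1)) * (hVal g m - (+ 2 / 1)) - (+ g / 1) * (hVal g m - (+ 4 / 1))) ≡ + m / 1
  ½[g²[h-2]-g[h-4]]≡m {suc (suc k)} m (s≤s (s≤s z≤n)) = begin
    ½ * ((g * g) * (h - + 2 / 1) - g * (h - + 4 / 1))
      ≡⟨ cong (λ x → ½ * ((x * x) * (h - + 2 / 1) - x * (h - + 4 / 1))) (ℤtoℚ-+ (+ 2) (+ k)) ⟩
    ½ * (((+ 2 / 1 + K) * (+ 2 / 1 + K)) * (h - + 2 / 1) - (+ 2 / 1 + K) * (h - + 4 / 1))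
      ≡⟨ solve 2 (λ h K → con ½ :* (((con (+ 2 / 1) :+ K) :* (con (+ 2 / 1) :+ K)) :* (h :- con (+ 2 / 1))
                               :- (con (+ 2 / 1) :+ K) :* (h :- con (+ 4 / 1)))
           := con ½ :* (h :* ((con (+ 2 / 1) :+ K) :* (con 1ℚ :+ K)) :- con (+ 2 / 1) :* ((con (+ 2 / 1) :+ K) :* (con (+ 2 / 1) :+ K))
                        :+ con (+ 4 / 1) :* (con (+ 2 / 1) :+ K))) refl h K ⟩
    ½ * (h * ((+ 2 / 1 + K) * (1ℚ + K)) - + 2 / 1 * ((+ 2 / 1 + K) * (+ 2 / 1 + K)) + + 4 / 1 * (+ 2 / 1 + K))
      ≡⟨ cong (λ x → ½ * (x - + 2 / 1 * ((+ 2 / 1 + K) * (+ 2 / 1 + K)) + + 4 / 1 * (+ 2 / 1 + K))) (hVal-equation k m) ⟩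
    ½ * (+ 2 / 1 * (A + (+ 2 / 1 + K) * K) - + 2 / 1 * ((+ 2 / 1 + K) * (+ 2 / 1 + K)) + + 4 / 1 * (+ 2 / 1 + K))
      ≡⟨ solve 2 (λ A K → con ½ :* (con (+ 2 / 1) :* (A :+ (con (+ 2 / 1) :+ K) :* K)
                               :- con (+ 2 / 1) :* ((con (+ 2 / 1) :+ K) :* (con (+ 2 / 1) :+ K)) :+ con (+ 4 / 1) :* (con (+ 2 / 1) :+ K))
           := A) refl A K ⟩
    A ∎
    where
    open ≡-Reasoning
    open +-*-Solver
    g h A K : ℚ
    g = + suc (suc k) / 1
    h = hVal (suc (suc k)) m
    A = ℤtoℚ (+ m)
    K = ℤtoℚ (+ k)

  ℤtoℚ-pos : ∀ n .{{_ : ℕ.NonZero n}} → ℚ.Positive (ℤtoℚ (+ n))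
  ℤtoℚ-pos n = ℚ.normalize-pos n 1

  *-cancelʳ-≡-pos : ∀ {p q} r .{{_ : ℚ.Positive r}} → p * r ≡ q * r → p ≡ q
  *-cancelʳ-≡-pos r eq = ℚ.≤-antisym (ℚ.*-cancelʳ-≤-pos r (ℚ.≤-reflexive eq)) (ℚ.*-cancelʳ-≤-pos r (ℚ.≤-reflexive (sym eq)))

  hVal≡ℤtoℚ⇔ : ∀ {g} m H → 2 ≤ g →
    (hVal g m ≡ ℤtoℚ H) ⇔ (H ℤ.* + (g ℕ.* (g ∸ 1)) ≡ + (2 ℕ.* (m ℕ.+ g ℕ.* (g ∸ 2))))
  hVal≡ℤtoℚ⇔ {suc (suc k)} m H 2≤g@(s≤s (s≤s z≤n)) = mk⇔
    (λ h≡H → ℤtoℚ-injective (trans (ℤtoℚ-* H G) (trans (cong (_* ℤtoℚ G) (sym h≡H)) h*G≡N)))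
    (λ H*G≡N → *-cancelʳ-≡-pos (ℤtoℚ G) {{ℤtoℚ-pos (suc (suc k) ℕ.* suc k)}}
                  (trans h*G≡N (trans (cong ℤtoℚ (sym H*G≡N)) (ℤtoℚ-* H G))))
    where
    G : ℤ
    G = + (suc (suc k) ℕ.* suc k)
    h*G≡N : hVal (suc (suc k)) m * ℤtoℚ G ≡ ℤtoℚ (+ (2 ℕ.* (m ℕ.+ suc (suc k) ℕ.* k)))
    h*G≡N = hVal*g[g∸1]≡2[m+g[g∸2]] m 2≤g

  hVal≡ℤtoℚ+⇔ : ∀ {g} m h → 2 ≤ g →
    (hVal g m ≡ ℤtoℚ (+ h)) ⇔ (h ℕ.* (g ℕ.* (g ∸ 1)) ≡ 2 ℕ.* (m ℕ.+ g ℕ.* (g ∸ 2)))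
  hVal≡ℤtoℚ+⇔ {g} m h 2≤g = mk⇔
    (λ h≡H → ℤ.+-injective (trans (ℤ.pos-* h _) (Equivalence.to (hVal≡ℤtoℚ⇔ m (+ h) 2≤g) h≡H)))
    (λ h*G≡N → Equivalence.from (hVal≡ℤtoℚ⇔ m (+ h) 2≤g) (trans (sym (ℤ.pos-* h _)) (cong +_ h*G≡N)))

  hVal-positive : ∀ {g m} → 2 ≤ g → 1 ≤ m → 0ℚ ℚ.< hVal g m
  hVal-positive {suc (suc k)} {suc m} 2≤g@(s≤s (s≤s z≤n)) _ =
    ℚ.*-cancelʳ-<-nonNeg G {{ℚ.pos⇒nonNeg G {{ℤtoℚ-pos (suc (suc k) ℕ.* suc k)}}}}
      (subst₂ ℚ._<_ (sym (ℚ.*-zeroˡ G)) (sym (hVal*g[g∸1]≡2[m+g[g∸2]] (suc m) 2≤g))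
        (ℚ.positive⁻¹ _ {{ℤtoℚ-pos (2 ℕ.* (suc m ℕ.+ suc (suc k) ℕ.* k))}}))
    where
    G : ℚ
    G = ℤtoℚ (+ (suc (suc k) ℕ.* suc k))

module Integrality where

  open Parameter
  open import Data.Nat as ℕ using (ℕ; zero; suc; _+_; _*_; _≤_; _<_; _∸_; s≤s; z≤n)
  import Data.Nat.Properties as ℕ
  import Data.Nat.DivMod as ℕ
  open import Data.Nat.Divisibility using (_∣_; divides; ∣m+n∣m⇒∣n; n∣m*n; m∣m*n)
  open import Data.Nat.Tactic.RingSolver using (solve-∀)
  open import Data.Integer as ℤ using (ℤ; +_; -[1+_])
  import Data.Integer.Properties as ℤ
  import Data.Integer.Tactic.RingSolver as ℤ-Ring
  open import Data.Product using (Σ; _,_)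
  open import Data.Rational using (_/_)
  open import Data.Empty using (⊥-elim)
  open import Function.Bundles using (_⇔_; mk⇔; Equivalence)
  open import Relation.Binary.PropositionalEquality

  *-pos≡pos⇒1≤ : ∀ {H a b} → H ℤ.* + suc a ≡ + suc b → + 1 ℤ.≤ H
  *-pos≡pos⇒1≤ {+ suc _}  _  = ℤ.+≤+ (s≤s z≤n)
  *-pos≡pos⇒1≤ {+ zero}   ()
  *-pos≡pos⇒1≤ { -[1+ _ ]} ()

  hVal≡ℤtoℚ⇒1≤H : ∀ {g m} H → 2 ≤ g → 1 ≤ m → hVal g m ≡ ℤtoℚ H → + 1 ℤ.≤ H
  hVal≡ℤtoℚ⇒1≤H {m = m} H 2≤g@(s≤s (s≤s z≤n)) (s≤s z≤n) h≡H =
    *-pos≡pos⇒1≤ (Equivalence.to (hVal≡ℤtoℚ⇔ m H 2≤g) h≡H)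

  hVal≡ℤtoℚ⇒polygonal : ∀ {g m} H → 2 ≤ g → hVal g m ≡ ℤtoℚ H → + m ≡ Polygonal H g
  hVal≡ℤtoℚ⇒polygonal {suc (suc k)} {m} H 2≤g@(s≤s (s≤s z≤n)) h≡H = sym (begin
    Polygonal H (suc (suc k))                              ≡⟨ cong (ℤ._/ℕ 2) (expand H (+ k)) ⟩
    (H ℤ.* G ℤ.- + 2 ℤ.* ((+ 2 ℤ.+ + k) ℤ.* + k)) ℤ./ℕ 2   ≡⟨ cong (λ x → (x ℤ.- + 2 ℤ.* ((+ 2 ℤ.+ + k) ℤ.* + k)) ℤ./ℕ 2) H*G≡N ⟩
    (N ℤ.- + 2 ℤ.* ((+ 2 ℤ.+ + k) ℤ.* + k)) ℤ./ℕ 2         ≡⟨ cong (ℤ._/ℕ 2) (trans (cancel (+ m) (+ k)) (sym (ℤ.pos-* m 2))) ⟩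
    + (m * 2) ℤ./ℕ 2                                      ≡⟨ cong +_ (ℕ.m*n/n≡m m 2) ⟩
    + m                                                   ∎)
    where
    open ≡-Reasoning
    G N : ℤ
    G = (+ 2 ℤ.+ + k) ℤ.* (+ 1 ℤ.+ + k)
    N = + 2 ℤ.* (+ m ℤ.+ (+ 2 ℤ.+ + k) ℤ.* + k)
    expand : ∀ H K → (((+ 2 ℤ.+ K) ℤ.* (+ 2 ℤ.+ K)) ℤ.* (H ℤ.- + 2) ℤ.- (+ 2 ℤ.+ K) ℤ.* (H ℤ.- + 4))
                   ≡ H ℤ.* ((+ 2 ℤ.+ K) ℤ.* (+ 1 ℤ.+ K)) ℤ.- + 2 ℤ.* ((+ 2 ℤ.+ K) ℤ.* K)
    expand = ℤ-Ring.solve-∀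
    cancel : ∀ M K → + 2 ℤ.* (M ℤ.+ (+ 2 ℤ.+ K) ℤ.* K) ℤ.- + 2 ℤ.* ((+ 2 ℤ.+ K) ℤ.* K) ≡ M ℤ.* + 2
    cancel = ℤ-Ring.solve-∀
    H*G≡N : H ℤ.* G ≡ N
    H*G≡N = begin
      H ℤ.* G                                  ≡⟨ cong (H ℤ.*_) (ℤ.pos-* (suc (suc k)) (suc k)) ⟨
      H ℤ.* + (suc (suc k) * suc k)            ≡⟨ Equivalence.to (hVal≡ℤtoℚ⇔ m H 2≤g) h≡H ⟩
      + (2 * (m + suc (suc k) * k))            ≡⟨ ℤ.pos-* 2 (m + suc (suc k) * k) ⟩
      + 2 ℤ.* + (m + suc (suc k) * k)          ≡⟨ cong (λ x → + 2 ℤ.* (+ m ℤ.+ x)) (ℤ.pos-* (suc (suc k)) k) ⟩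
      N                                        ∎

  m≡g⇔hVal≡2 : ∀ {g} m → 2 ≤ g → (m ≡ g) ⇔ (hVal g m ≡ + 2 / 1)
  m≡g⇔hVal≡2 {suc (suc k)} m 2≤g@(s≤s (s≤s z≤n)) = mk⇔
    (λ { refl → Equivalence.from (hVal≡ℤtoℚ+⇔ g 2 2≤g) (cong (2 *_) g[g∸1]≡g+g[g∸2]) })
    (λ h≡2 → ℕ.+-cancelʳ-≡ (g * k) m g (ℕ.*-cancelˡ-≡ (m + g * k) (g + g * k) 2
               (trans (sym (Equivalence.to (hVal≡ℤtoℚ+⇔ m 2 2≤g) h≡2)) (cong (2 *_) g[g∸1]≡g+g[g∸2]))))
    where
    g : ℕ
    g = suc (suc k)
    g[g∸1]≡g+g[g∸2] : g * suc k ≡ g + g * k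
    g[g∸1]≡g+g[g∸2] = ℕ.*-suc g k

  g≡2⇔hVal≡m : ∀ {g} m → 2 ≤ g → 1 ≤ m → (g ≡ 2) ⇔ (hVal g m ≡ + m / 1)
  g≡2⇔hVal≡m {suc (suc k)} m 2≤g@(s≤s (s≤s z≤n)) 1≤m = mk⇔
    (λ { refl → Equivalence.from (hVal≡ℤtoℚ+⇔ m m 2≤g) (m*2≡2[m+0] m) })
    (λ h≡m → g≡2 k m 1≤m (Equivalence.to (hVal≡ℤtoℚ+⇔ m m 2≤g) h≡m))
    where
    m*2≡2[m+0] : ∀ m → m * 2 ≡ 2 * (m + 2 * 0)
    m*2≡2[m+0] = solve-∀
    surplus₁ : ∀ j → 2 * (1 + (3 + j) * (1 + j)) ≡ suc (1 * ((3 + j) * (2 + j)) + (j * j + 3 * j + 1))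
    surplus₁ = solve-∀
    surplus₂ : ∀ j n → (2 + n) * ((3 + j) * (2 + j)) ≡ suc (2 * ((2 + n) + (3 + j) * (1 + j)) + (2 * j + 1 + n * (j * j + 5 * j + 4)))
    surplus₂ = solve-∀
    g≡2 : ∀ k m → 1 ≤ m → m * ((2 + k) * (1 + k)) ≡ 2 * (m + (2 + k) * k) → 2 + k ≡ 2
    g≡2 zero    m             _ _  = refl
    g≡2 (suc j) 1             _ eq = ⊥-elim (ℕ.m≢1+m+n _ (trans eq (surplus₁ j)))
    g≡2 (suc j) (suc (suc n)) _ eq = ⊥-elim (ℕ.m≢1+m+n _ (trans (sym eq) (surplus₂ j n)))

  hVal[[1+c[g∸1]]*g]≡2[1+c] : ∀ {g} c → 2 ≤ g → hVal g ((1 + c * (g ∸ 1)) * g) ≡ ℤtoℚ (+ (2 * (1 + c)))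
  hVal[[1+c[g∸1]]*g]≡2[1+c] {suc (suc k)} c 2≤g@(s≤s (s≤s z≤n)) =
    Equivalence.from (hVal≡ℤtoℚ+⇔ ((1 + c * suc k) * suc (suc k)) (2 * (1 + c)) 2≤g) (equation c k)
    where
    equation : ∀ c k → 2 * (1 + c) * ((2 + k) * (1 + k)) ≡ 2 * ((1 + c * (1 + k)) * (2 + k) + (2 + k) * k)
    equation = solve-∀

  cofactor≡1+c[g∸1] : ∀ {g x} → 1 ≤ g → 1 ≤ x → (g ∸ 1) ∣ (x * g ∸ 1) → Σ ℕ λ c → x ≡ 1 + c * (g ∸ 1)
  cofactor≡1+c[g∸1] {suc n} {suc r} _ _ n∣x*g∸1 with ∣m+n∣m⇒∣n (subst (n ∣_) (x*g∸1≡ n r) n∣x*g∸1) (n∣m*n (suc r))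
    where
    x*g∸1≡ : ∀ n r → n + r * suc n ≡ suc r * n + r
    x*g∸1≡ = solve-∀
  ... | divides c r≡c*n = c , cong suc r≡c*n

  evenIntAtLeast-[1+c[g∸1]]*g : ∀ {g} c lb → 2 ≤ g → lb ≤ 2 * (1 + c) →
    EvenIntAtLeast (+ lb) (hVal g ((1 + c * (g ∸ 1)) * g))
  evenIntAtLeast-[1+c[g∸1]]*g c lb 2≤g lb≤ =
    + (2 * (1 + c)) , hVal[[1+c[g∸1]]*g]≡2[1+c] c 2≤g , m∣m*n (1 + c) , ℤ.+≤+ lb≤

  evenIntAtLeast4-x*g : ∀ {g x} → 2 ≤ g → 2 ≤ x → (g ∸ 1) ∣ (x * g ∸ 1) → EvenIntAtLeast (+ 4) (hVal g (x * g))
  evenIntAtLeast4-x*g 2≤g 2≤x g∸1∣ with cofactor≡1+c[g∸1] (ℕ.<⇒≤ 2≤g) (ℕ.<⇒≤ 2≤x) g∸1∣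
  ... | zero  , refl = ⊥-elim (ℕ.<-irrefl refl 2≤x)
  ... | suc c , refl = evenIntAtLeast-[1+c[g∸1]]*g (suc c) 4 2≤g (ℕ.*-monoʳ-≤ 2 (s≤s (s≤s z≤n)))

  evenIntAtLeast6-x*g : ∀ {g x} → 2 ≤ g → 2 ≤ x → x ≢ g → (g ∸ 1) ∣ (x * g ∸ 1) → EvenIntAtLeast (+ 6) (hVal g (x * g))
  evenIntAtLeast6-x*g 2≤g 2≤x x≢g g∸1∣ with cofactor≡1+c[g∸1] (ℕ.<⇒≤ 2≤g) (ℕ.<⇒≤ 2≤x) g∸1∣
  ... | zero        , refl = ⊥-elim (ℕ.<-irrefl refl 2≤x)
  ... | suc zero    , refl = ⊥-elim (x≢g (1+[g∸1]≡g 2≤g))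
    where
    1+[g∸1]≡g : ∀ {g} → 2 ≤ g → 1 + 1 * (g ∸ 1) ≡ g
    1+[g∸1]≡g {suc g∸1} _ = cong suc (ℕ.*-identityˡ g∸1)
  ... | suc (suc c) , refl = evenIntAtLeast-[1+c[g∸1]]*g (suc (suc c)) 6 2≤g (ℕ.*-monoʳ-≤ 2 (s≤s (s≤s (s≤s z≤n))))

  evenIntAtLeast4-∣ : ∀ {g m} → 2 ≤ g → g < m → g ∣ m → (g ∸ 1) ∣ (m ∸ 1) → EvenIntAtLeast (+ 4) (hVal g m)
  evenIntAtLeast4-∣ 2≤g g<m (divides x refl) = evenIntAtLeast4-x*g 2≤g (2≤x x g<m)
    where
    2≤x : ∀ {g} x → g < x * g → 2 ≤ x
    2≤x {g} 1 g<g = ⊥-elim (ℕ.<-irrefl (sym (ℕ.+-identityʳ g)) g<g)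
    2≤x (suc (suc _)) _ = s≤s (s≤s z≤n)

module DigitSums where

  open Integrality
  open import Data.Nat as ℕ using (ℕ; zero; suc; _+_; _*_; _≤_; _<_; _∸_; _%_; _/_; s≤s; z≤n)
  import Data.Nat.Properties as ℕ
  import Data.Nat.DivMod as ℕ
  open import Data.Nat.Divisibility using (_∣_; divides)
  open import Data.Nat.Tactic.RingSolver using (solve-∀)
  import Data.Integer as ℤ
  open import Data.Product using (Σ; _,_)
  open import Data.Empty using (⊥-elim)
  open import Relation.Binary.PropositionalEquality

  module _ {g : ℕ} .{{_ : ℕ.NonZero g}} where

    digitSumAux-shift : ∀ f x → digitSumAux g (suc f) (x * g) ≡ digitSumAux g f x
    digitSumAux-shift f x = cong₂ (λ r q → r + digitSumAux g f q) (ℕ.m*n%n≡0 x g) (ℕ.m*n/n≡m x g)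

    digitSumAux[0]≡0 : ∀ f → digitSumAux g f 0 ≡ 0
    digitSumAux[0]≡0 zero    = refl
    digitSumAux[0]≡0 (suc f) = trans (digitSumAux-shift f 0) (digitSumAux[0]≡0 f)

    digitSumAux-digit : ∀ f {n} → n < g → digitSumAux g (suc f) n ≡ n
    digitSumAux-digit f {n} n<g = begin
      n % g + digitSumAux g f (n / g) ≡⟨ cong₂ (λ r q → r + digitSumAux g f q) (ℕ.m<n⇒m%n≡m n<g) (ℕ.m<n⇒m/n≡0 n<g) ⟩
      n + digitSumAux g f 0           ≡⟨ cong (n +_) (digitSumAux[0]≡0 f) ⟩
      n + 0                           ≡⟨ ℕ.+-identityʳ n ⟩
      n                               ∎
      where open ≡-Reasoning

    digitSumAux[1]≤1 : 1 < g → ∀ f → digitSumAux g f 1 ≤ 1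
    digitSumAux[1]≤1 _   zero    = z≤n
    digitSumAux[1]≤1 1<g (suc f) = ℕ.≤-reflexive (digitSumAux-digit f 1<g)

    digitSumAux[g]≤1 : 1 < g → ∀ f → digitSumAux g f g ≤ 1
    digitSumAux[g]≤1 _   zero    = z≤n
    digitSumAux[g]≤1 1<g (suc f) = subst (λ n → digitSumAux g (suc f) n ≤ 1) (ℕ.*-identityˡ g)
      (ℕ.≤-trans (ℕ.≤-reflexive (digitSumAux-shift f 1)) (digitSumAux[1]≤1 1<g f))

    -- n ≤ f: every step divides n by g ≥ 2, so f steps exhaust n
    n≡digitSumAux+[g∸1]*T : 1 < g → ∀ f n → n ≤ f → Σ ℕ λ T → n ≡ digitSumAux g f n + (g ∸ 1) * T
    n≡digitSumAux+[g∸1]*T _   zero    zero    _   = 0 , sym (ℕ.*-zeroʳ (g ∸ 1))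
    n≡digitSumAux+[g∸1]*T 1<g (suc f) n       n≤f with n≡digitSumAux+[g∸1]*T 1<g f (n / g) (n/g≤f n n≤f)
      where
      n/g≤f : ∀ n → n ≤ suc f → n / g ≤ f
      n/g≤f zero    _   = subst (_≤ f) (sym (ℕ.0/n≡0 g)) z≤n
      n/g≤f (suc n) n≤f = ℕ.≤-pred (ℕ.≤-trans (ℕ.m/n<m (suc n) g 1<g) n≤f)
    ... | T , n/g≡ = T + n / g , (begin
      n                                                  ≡⟨ ℕ.m≡m%n+[m/n]*n n g ⟩
      n % g + n / g * g                                  ≡⟨ regroup (n % g) (n / g) ⟩
      n % g + n / g + (g ∸ 1) * (n / g)                  ≡⟨ cong (λ q → n % g + q + (g ∸ 1) * (n / g)) n/g≡ ⟩
      n % g + (digitSumAux g f (n / g) + (g ∸ 1) * T) + (g ∸ 1) * (n / g)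
                                                         ≡⟨ collect (n % g) (digitSumAux g f (n / g)) (g ∸ 1) T (n / g) ⟩
      n % g + digitSumAux g f (n / g) + (g ∸ 1) * (T + n / g) ∎)
      where
      open ≡-Reasoning
      g≡1+[g∸1] : g ≡ 1 + (g ∸ 1)
      g≡1+[g∸1] = sym (ℕ.m+[n∸m]≡n (ℕ.<⇒≤ 1<g))
      unfold-g : ∀ r q h → r + q * (1 + h) ≡ r + q + h * q
      unfold-g = solve-∀
      regroup : ∀ r q → r + q * g ≡ r + q + (g ∸ 1) * q
      regroup r q = trans (cong (λ d → r + q * d) g≡1+[g∸1]) (unfold-g r q (g ∸ 1))
      collect : ∀ r s h T q → r + (s + h * T) + h * q ≡ r + s + h * (T + q)
      collect = solve-∀

  digitSum≡g⇒[g∸1]∣m∸1 : ∀ {g m} → 2 ≤ g → digitSum g m ≡ g → (g ∸ 1) ∣ (m ∸ 1)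
  digitSum≡g⇒[g∸1]∣m∸1 {suc (suc k)} {m} 2≤g@(s≤s (s≤s z≤n)) s[m]≡g
    with n≡digitSumAux+[g∸1]*T 2≤g m m ℕ.≤-refl
  ... | T , m≡s[m]+[g∸1]*T = divides (suc T) (begin
    m ∸ 1                                   ≡⟨ cong (_∸ 1) m≡s[m]+[g∸1]*T ⟩
    digitSumAux (2 + k) m m + suc k * T ∸ 1 ≡⟨ cong (λ s → s + suc k * T ∸ 1) s[m]≡g ⟩
    suc k + suc k * T                       ≡⟨ ℕ.*-suc (suc k) T ⟨
    suc k * suc T                           ≡⟨ ℕ.*-comm (suc k) (suc T) ⟩
    suc T * suc k                           ∎)
    where open ≡-Reasoning

  evenIntAtLeast6-digitSum : ∀ {g m} → 2 ≤ g → g ∣ m → digitSum g m ≡ g → EvenIntAtLeast (ℤ.+ 6) (hVal g m)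
  evenIntAtLeast6-digitSum {suc (suc _)} 2≤g (divides zero refl) ()
  evenIntAtLeast6-digitSum {g@(suc (suc _))} 2≤g@(s≤s (s≤s z≤n)) (divides x@(suc _) refl) s[m]≡g =
    evenIntAtLeast6-x*g 2≤g (2≤x (ℕ.pred (x * g)) x s[x]≡g) (x≢g (ℕ.pred (x * g)) s[x]≡g)
      (digitSum≡g⇒[g∸1]∣m∸1 2≤g s[m]≡g)
    where
    s[x]≡g : digitSumAux g (ℕ.pred (x * g)) x ≡ g
    s[x]≡g = trans (sym (digitSumAux-shift (ℕ.pred (x * g)) x)) s[m]≡g
    2≤x : ∀ f y → digitSumAux g f y ≡ g → 2 ≤ y
    2≤x f 0           s[0]≡g = ⊥-elim (ℕ.0≢1+n (trans (sym (digitSumAux[0]≡0 f)) s[0]≡g))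
    2≤x f 1           s[1]≡g = ⊥-elim (ℕ.<⇒≱ (s≤s (s≤s z≤n)) (subst (_≤ 1) s[1]≡g (digitSumAux[1]≤1 2≤g f)))
    2≤x _ (suc (suc _)) _      = s≤s (s≤s z≤n)
    x≢g : ∀ f {y} → digitSumAux g f y ≡ g → y ≢ g
    x≢g f s[g]≡g refl = ℕ.<⇒≱ (s≤s (s≤s z≤n)) (subst (_≤ 1) s[g]≡g (digitSumAux[g]≤1 2≤g f))

module Factors where

  open Integrality
  open DigitSums
  open import Data.Nat as ℕ using (ℕ; suc; _+_; _^_; _≤_; _<_; _∸_; s≤s; z≤n)
  import Data.Nat.Properties as ℕ
  open import Data.Nat.Divisibility using (_∣_; ∣-trans; m∣m*n)
  open import Data.Nat.ListAction.Properties using (∈⇒∣product)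
  import Data.Integer as ℤ
  open import Data.List using (map)
  open import Data.List.Membership.Propositional using (_∈_)
  open import Data.List.Membership.Propositional.Properties using (∈-map⁺; ∈-map⁻; ∈-tabulate⁺)
  import Data.List.Relation.Unary.All as All
  open import Data.Fin using (Fin)
  open import Data.Product using (_×_; _,_; proj₁; proj₂)
  open import Relation.Binary.PropositionalEquality
  open import Relation.Nullary using (¬_)

  sDecomp-factor : ∀ {m d g} → StrictSDecomp m d → g ∈ map proj₁ d → g ∣ m × digitSum g m ≡ g
  sDecomp-factor (_ , factors , product≡m) g∈d with ∈-map⁻ proj₁ g∈d
  ... | (g , e) , ge∈d , refl with All.lookup factors ge∈d
  ... | 1≤e , _ , _ , s[m]≡g =
    subst (g ∣_) product≡m (∣-trans (g∣g^e 1≤e) (∈⇒∣product (∈-map⁺ (λ p → proj₁ p ^ proj₂ p) ge∈d))) , s[m]≡g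
    where
    g∣g^e : ∀ {e} → 1 ≤ e → g ∣ g ^ e
    g∣g^e {suc e} _ = m∣m*n (g ^ e)

  linFactor∣Uform : ∀ {n} (a b : Fin n → ℕ) ν t → linFactor a b ν t ∣ Uform a b t
  linFactor∣Uform a b ν t = ∈⇒∣product (∈-tabulate⁺ {f = λ μ → linFactor a b μ t} ν)

  ∣+n-+1∣≡n∸1 : ∀ {n} → 1 ≤ n → ℤ.∣ ℤ.+ n ℤ.- ℤ.+ 1 ∣ ≡ n ∸ 1
  ∣+n-+1∣≡n∸1 {suc n} _ = refl

  universalForm-congruence : ∀ {n a b} → UniversalForm n a b → ∀ ν t → 1 < linFactor a b ν t → 1 ≤ Uform a b t →
    (linFactor a b ν t ∸ 1) ∣ (Uform a b t ∸ 1)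
  universalForm-congruence {a = a} {b} (_ , _ , _ , _ , universal) ν t 1<g 1≤U =
    subst₂ _∣_ (∣+n-+1∣≡n∸1 (ℕ.<⇒≤ 1<g)) (∣+n-+1∣≡n∸1 1≤U) (universal ν t not-exceptional)
    where
    not-exceptional : ¬ ((t ≡ 0) × (b ν ≡ 1))
    not-exceptional (refl , bν≡1) = ℕ.<-irrefl (sym (trans (cong (_+ b ν) (ℕ.*-zeroʳ (a ν))) bν≡1)) 1<g

  evenIntAtLeast6-sDecomp : ∀ {g m d} → 2 ≤ g → StrictSDecomp m d → g ∈ map proj₁ d → EvenIntAtLeast (ℤ.+ 6) (hVal g m)
  evenIntAtLeast6-sDecomp 2≤g decomposition g∈d with sDecomp-factor decomposition g∈d
  ... | g∣m , s[m]≡g = evenIntAtLeast6-digitSum 2≤g g∣m s[m]≡g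

  evenIntAtLeast4-universalForm : ∀ {n a b} → UniversalForm n a b → ∀ ν t →
    linFactor a b ν t < Uform a b t → 1 < linFactor a b ν t →
    EvenIntAtLeast (ℤ.+ 4) (hVal (linFactor a b ν t) (Uform a b t))
  evenIntAtLeast4-universalForm {a = a} {b} U ν t g<U 1<g =
    evenIntAtLeast4-∣ 1<g g<U (linFactor∣Uform a b ν t) (universalForm-congruence U ν t 1<g (ℕ.≤-trans (s≤s z≤n) g<U))

module Congruences where

  open import Data.Nat as ℕ using (ℕ; zero; suc)
  import Data.Nat.Divisibility as ℕ
  open import Data.Nat.Primality using (Prime; euclidsLemma)
  open import Data.Integer as ℤ using (ℤ; +_; _+_; _*_; _-_; -_; _^_)
  import Data.Integer.Properties as ℤ
  open import Data.Integer.Divisibility.Signed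
  import Data.Integer.Tactic.RingSolver as ℤ-Ring
  open import Data.Sum using (_⊎_; inj₁; inj₂)
  open import Relation.Binary.PropositionalEquality

  infix 4 _≡_mod_

  record _≡_mod_ (a b : ℤ) (n : ℕ) : Set where
    constructor ≡mod
    field divides-difference : + n ∣ a - b

  open _≡_mod_ public

  module _ {n : ℕ} where

    ∣-respʳ-≡ : ∀ {a b} → a ≡ b → + n ∣ a → + n ∣ b
    ∣-respʳ-≡ refl n∣a = n∣a

    ≡-mod-refl : ∀ {a} → a ≡ a mod n
    ≡-mod-refl {a} = ≡mod (divides (+ 0) (ℤ.+-inverseʳ a))

    ≡-mod-reflexive : ∀ {a b} → a ≡ b → a ≡ b mod n
    ≡-mod-reflexive refl = ≡-mod-refl

    ≡-mod-sym : ∀ {a b} → a ≡ b mod n → b ≡ a mod n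
    ≡-mod-sym {a} {b} (≡mod n∣a-b) = ≡mod (∣-respʳ-≡ (negate a b) (∣m⇒∣-m n∣a-b))
      where
      negate : ∀ a b → - (a - b) ≡ b - a
      negate = ℤ-Ring.solve-∀

    ≡-mod-trans : ∀ {a b c} → a ≡ b mod n → b ≡ c mod n → a ≡ c mod n
    ≡-mod-trans {a} {b} {c} (≡mod n∣a-b) (≡mod n∣b-c) = ≡mod (∣-respʳ-≡ (telescope a b c) (∣m∣n⇒∣m+n n∣a-b n∣b-c))
      where
      telescope : ∀ a b c → (a - b) + (b - c) ≡ a - c
      telescope = ℤ-Ring.solve-∀

    +-cong-mod : ∀ {a b c d} → a ≡ b mod n → c ≡ d mod n → a + c ≡ b + d mod n
    +-cong-mod {a} {b} {c} {d} (≡mod n∣a-b) (≡mod n∣c-d) = ≡mod (∣-respʳ-≡ (regroup a b c d) (∣m∣n⇒∣m+n n∣a-b n∣c-d))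
      where
      regroup : ∀ a b c d → (a - b) + (c - d) ≡ (a + c) - (b + d)
      regroup = ℤ-Ring.solve-∀

    *-cong-mod : ∀ {a b c d} → a ≡ b mod n → c ≡ d mod n → a * c ≡ b * d mod n
    *-cong-mod {a} {b} {c} {d} (≡mod n∣a-b) (≡mod n∣c-d) =
      ≡mod (∣-respʳ-≡ (split a b c d) (∣m∣n⇒∣m+n (∣m⇒∣m*n c n∣a-b) (∣n⇒∣m*n b n∣c-d)))
      where
      split : ∀ a b c d → (a - b) * c + b * (c - d) ≡ a * c - b * d
      split = ℤ-Ring.solve-∀

    ^-cong-mod : ∀ {a b} e → a ≡ b mod n → a ^ e ≡ b ^ e mod n
    ^-cong-mod zero    _   = ≡-mod-refl
    ^-cong-mod (suc e) a≡b = *-cong-mod a≡b (^-cong-mod e a≡b)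

    +-multiple-mod : ∀ a c → a + c * + n ≡ a mod n
    +-multiple-mod a c = ≡mod (divides c (cancel a c (+ n)))
      where
      cancel : ∀ a c n → a + c * n - a ≡ c * n
      cancel = ℤ-Ring.solve-∀

  euclidsLemma-ℤ : ∀ {p} → Prime p → ∀ a b → + p ∣ a * b → + p ∣ a ⊎ + p ∣ b
  euclidsLemma-ℤ pr a b p∣ab with euclidsLemma ℤ.∣ a ∣ ℤ.∣ b ∣ pr (subst (_ ℕ.∣_) (ℤ.abs-* a b) (∣⇒∣ᵤ p∣ab))
  ... | inj₁ p∣a = inj₁ (∣ᵤ⇒∣ p∣a)
  ... | inj₂ p∣b = inj₂ (∣ᵤ⇒∣ p∣b)

module Polynomials where

  open Congruences
  open import Data.Nat as ℕ using (ℕ; zero; suc; _≤_; _<_; _∸_; s≤s; z≤n)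
  import Data.Nat.Properties as ℕ
  import Data.Nat.Divisibility as ℕ
  open import Data.Nat.Primality using (Prime; ¬prime[1])
  open import Data.Integer as ℤ using (ℤ; +_; -[1+_]; _+_; _*_; _-_; _^_)
  import Data.Integer.Properties as ℤ
  open import Data.Integer.Divisibility.Signed
  import Data.Integer.Tactic.RingSolver as ℤ-Ring
  open import Data.List using (List; []; _∷_; length)
  open import Data.Sum using (inj₁; inj₂)
  open import Data.Empty using (⊥-elim)
  open import Relation.Nullary using (¬_)
  open import Relation.Binary.PropositionalEquality

  -- Polynomials are coefficient lists, constant term first.
  eval : List ℤ → ℤ → ℤ
  eval []       x = + 0
  eval (c ∷ cs) x = c + x * eval cs x

  divideBy : ℤ → List ℤ → List ℤ
  divideBy r []           = []
  divideBy r (c ∷ [])     = []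
  divideBy r (c ∷ d ∷ cs) = eval (d ∷ cs) r ∷ divideBy r (d ∷ cs)

  factor-theorem : ∀ r f x → eval f x ≡ (x - r) * eval (divideBy r f) x + eval f r
  factor-theorem r []           x = ℤ-Ring.solve (x ∷ r ∷ [])
  factor-theorem r (c ∷ [])     x = constant c x r
    where
    constant : ∀ c x r → c + x * + 0 ≡ (x - r) * + 0 + (c + r * + 0)
    constant = ℤ-Ring.solve-∀
  factor-theorem r (c ∷ d ∷ cs) x = begin
    c + x * eval (d ∷ cs) x                                  ≡⟨ cong (λ e → c + x * e) (factor-theorem r (d ∷ cs) x) ⟩
    c + x * ((x - r) * eval (divideBy r (d ∷ cs)) x + eval (d ∷ cs) r)
                                                             ≡⟨ regroup c x r (eval (divideBy r (d ∷ cs)) x) (eval (d ∷ cs) r) ⟩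
    (x - r) * (eval (d ∷ cs) r + x * eval (divideBy r (d ∷ cs)) x) + (c + r * eval (d ∷ cs) r) ∎
    where
    open ≡-Reasoning
    regroup : ∀ c x r q e → c + x * ((x - r) * q + e) ≡ (x - r) * (e + x * q) + (c + r * e)
    regroup = ℤ-Ring.solve-∀

  length-divideBy : ∀ r f {n} → length f ≤ suc n → length (divideBy r f) ≤ n
  length-divideBy r []           _               = z≤n
  length-divideBy r (c ∷ [])     _               = z≤n
  length-divideBy r (c ∷ d ∷ cs) {suc n} (s≤s ℓ≤) = s≤s (length-divideBy r (d ∷ cs) ℓ≤)

  ¬∣[i-j] : ∀ {p i j} → i < j → j < p → ¬ (+ p ∣ + i - + j)
  ¬∣[i-j] {p} {i} {j} i<j j<p p∣i-j =
    ℕ.<⇒≱ (ℕ.≤-<-trans (ℕ.m∸n≤m j i) j<p) (ℕ.∣⇒≤ {{ℕ.>-nonZero (ℕ.m<n⇒0<n∸m i<j)}} p∣j∸i)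
    where
    ∣i-j∣≡j∸i : ℤ.∣ + i - + j ∣ ≡ j ∸ i
    ∣i-j∣≡j∸i = trans (cong ℤ.∣_∣ (trans (ℤ.m-n≡m⊖n i j) (ℤ.⊖-≤ (ℕ.<⇒≤ i<j)))) (ℤ.∣-i∣≡∣i∣ (+ (j ∸ i)))
    p∣j∸i : p ℕ.∣ j ∸ i
    p∣j∸i = subst (p ℕ.∣_) ∣i-j∣≡j∸i (∣⇒∣ᵤ p∣i-j)

  lagrange : ∀ {p} → Prime p → ∀ n → n < p → ∀ f → length f ≤ n →
    (∀ i → 1 ≤ i → i ≤ n → + p ∣ eval f (+ i)) → ∀ x → + p ∣ eval f x
  lagrange _  _       _   []          _ _     _ = divides (+ 0) refl
  lagrange {p} pr (suc n) n<p f@(_ ∷ _) ℓ≤ roots x =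
    ∣-respʳ-≡ (sym (factor-theorem r f x)) (∣m∣n⇒∣m+n (∣n⇒∣m*n (x - r) (q-vanishes x)) f[r]≡0)
    where
    r : ℤ
    r = + suc n
    f[r]≡0 : + p ∣ eval f r
    f[r]≡0 = roots (suc n) (s≤s z≤n) ℕ.≤-refl
    q-roots : ∀ i → 1 ≤ i → i ≤ n → + p ∣ eval (divideBy r f) (+ i)
    q-roots i 1≤i i≤n with euclidsLemma-ℤ pr (+ i - r) (eval (divideBy r f) (+ i))
        (∣m+n∣n⇒∣m (∣-respʳ-≡ (factor-theorem r f (+ i)) (roots i 1≤i (ℕ.m≤n⇒m≤1+n i≤n))) f[r]≡0)
    ... | inj₁ p∣i-r = ⊥-elim (¬∣[i-j] (s≤s i≤n) n<p p∣i-r)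
    ... | inj₂ p∣q   = p∣q
    q-vanishes : ∀ x → + p ∣ eval (divideBy r f) x
    q-vanishes = lagrange pr n (ℕ.<-trans (ℕ.n<1+n n) n<p) (divideBy r f) (length-divideBy r f ℓ≤) q-roots

  monomial : ℕ → List ℤ
  monomial zero    = + 1 ∷ []
  monomial (suc d) = + 0 ∷ monomial d

  eval-monomial : ∀ d x → eval (monomial d) x ≡ x ^ d
  eval-monomial zero    x = cong (λ y → + 1 + y) (ℤ.*-zeroʳ x)
  eval-monomial (suc d) x = trans (ℤ.+-identityˡ (x * eval (monomial d) x)) (cong (x *_) (eval-monomial d x))

  length-monomial : ∀ d → length (monomial d) ≡ suc d
  length-monomial zero    = refl
  length-monomial (suc d) = cong suc (length-monomial d)

  ¬all-roots-of-unity : ∀ {p e} → Prime p → 1 ≤ e → e < p ∸ 1 → ¬ (∀ a → 1 ≤ a → a < p → (+ a) ^ e ≡ + 1 mod p)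
  ¬all-roots-of-unity {suc n} {suc d} pr _ e<n roots = ¬prime[1] (subst Prime p≡1 pr)
    where
    f : List ℤ
    f = -[1+ 0 ] ∷ monomial d
    eval-f : ∀ x → eval f x ≡ x ^ suc d - + 1
    eval-f x = trans (cong (λ y → -[1+ 0 ] + x * y) (eval-monomial d x)) (ℤ.+-comm -[1+ 0 ] (x * x ^ d))
    p∣f[0] : + suc n ∣ eval f (+ 0)
    p∣f[0] = lagrange pr n ℕ.≤-refl f (subst (_≤ n) (sym (cong suc (length-monomial d))) e<n)
      (λ i 1≤i i≤n → ∣-respʳ-≡ (sym (eval-f (+ i))) (divides-difference (roots i 1≤i (s≤s i≤n)))) (+ 0)
    p≡1 : suc n ≡ 1
    p≡1 = ℕ.∣1⇒≡1 (subst (suc n ℕ.∣_) (cong ℤ.∣_∣ (eval-f (+ 0))) (∣⇒∣ᵤ p∣f[0]))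

module FermatLittle where

  open Congruences

  open import Data.Nat as ℕ using (ℕ; zero; suc; _+_; _*_; _^_; _≤_; _<_; _∸_; _!; s≤s; z≤n)
  import Data.Nat.Properties as ℕ
  import Data.Nat.DivMod as ℕ
  open import Data.Nat.Divisibility using (_∣_; module _∣_; _∣0; ∣m∣n⇒∣m+n; ∣m⇒∣m*n; m∣m*n; ∣⇒≤; ∣1⇒≡1)
  open import Data.Nat.Combinatorics using (_C_; nCk≡n!/k![n-k]!; k![n∸k]!∣n!; nCn≡1)
  open import Data.Nat.Primality using (Prime; euclidsLemma; ¬prime[1])
  open import Data.Nat.Tactic.RingSolver using (solve-∀)
  open import Data.Fin using (Fin; zero; suc; toℕ; fromℕ; inject₁)
  import Data.Fin.Properties as Fin
  open import Data.Integer as ℤ using (ℤ; +_)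
  import Data.Integer.Properties as ℤ
  open import Data.Integer.Divisibility.Signed using (∣⇒∣ᵤ)
  import Data.Integer.Tactic.RingSolver as ℤ-Ring
  import Algebra.Properties.CommutativeSemiring.Binomial ℕ.+-*-commutativeSemiring as Binomial
  open import Algebra.Properties.Monoid.Sum ℕ.+-0-monoid using (sum; sum-init-last)
  import Algebra.Definitions.RawSemiring ℕ.+-*-rawSemiring as Semiring
  open import Data.Product using (Σ; _,_)
  open _∣_ using (quotient; equality)
  open import Data.Sum using (inj₁; inj₂)
  open import Data.Empty using (⊥-elim)
  open import Relation.Nullary using (¬_)
  open import Relation.Binary.PropositionalEquality

  prime∤n! : ∀ {p n} → Prime p → n < p → ¬ p ∣ n !
  prime∤n! {n = zero}  pr _   p∣1  = ¬prime[1] (subst Prime (∣1⇒≡1 p∣1) pr)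
  prime∤n! {n = suc n} pr n<p p∣n! with euclidsLemma (suc n) (n !) pr p∣n!
  ... | inj₁ p∣1+n = ℕ.<⇒≱ n<p (∣⇒≤ p∣1+n)
  ... | inj₂ p∣n!′ = prime∤n! pr (ℕ.<-trans (ℕ.n<1+n n) n<p) p∣n!′

  prime∣pCk : ∀ {p k} → Prime p → 1 ≤ k → k < p → p ∣ p C k
  prime∣pCk {p} {k} pr 1≤k k<p with euclidsLemma (p C k) (k ! * (p ∸ k) !) pr p∣pCk*k![p∸k]!
    where
    instance _ = ℕ._!*_!≢0 k (p ∸ k)
    p∣p! : ∀ {p} → 1 ≤ p → p ∣ p !
    p∣p! {suc q} _ = m∣m*n (q !)
    p∣pCk*k![p∸k]! : p ∣ (p C k) * (k ! * (p ∸ k) !)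
    p∣pCk*k![p∸k]! = subst (p ∣_)
      (sym (trans (cong (_* (k ! * (p ∸ k) !)) (nCk≡n!/k![n-k]! (ℕ.<⇒≤ k<p))) (ℕ.m/n*n≡m (k![n∸k]!∣n! (ℕ.<⇒≤ k<p)))))
      (p∣p! (ℕ.<-≤-trans 1≤k (ℕ.<⇒≤ k<p)))
  ... | inj₁ p∣pCk = p∣pCk
  ... | inj₂ p∣k!*[p∸k]! with euclidsLemma (k !) ((p ∸ k) !) pr p∣k!*[p∸k]!
  ...   | inj₁ p∣k!     = ⊥-elim (prime∤n! pr k<p p∣k!)
  ...   | inj₂ p∣[p∸k]! = ⊥-elim (prime∤n! pr (ℕ.∸-monoʳ-< 1≤k (ℕ.<⇒≤ k<p)) p∣[p∸k]!)

  private
    semiring-^ : ∀ x n → x Semiring.^ n ≡ x ^ n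
    semiring-^ x zero    = refl
    semiring-^ x (suc n) = cong (x *_) (semiring-^ x n)

    semiring-× : ∀ n x → n Semiring.× x ≡ n * x
    semiring-× zero    x = refl
    semiring-× (suc n) x = cong (λ y → x + y) (semiring-× n x)

  ∣-sum : ∀ {d n} (u : Fin n → ℕ) → (∀ i → d ∣ u i) → d ∣ sum u
  ∣-sum {d} {zero}  u _   = d ∣0
  ∣-sum {n = suc n} u d∣u = ∣m∣n⇒∣m+n (d∣u zero) (∣-sum (λ i → u (suc i)) (λ i → d∣u (suc i)))

  [1+a]^p≡1+a^p+w*p : ∀ {p} → Prime p → ∀ a → Σ ℕ λ w → suc a ^ p ≡ 1 + a ^ p + w * p
  [1+a]^p≡1+a^p+w*p {suc q} pr a = w , (begin
    suc a ^ suc q                                                          ≡⟨ semiring-^ (1 + a) (suc q) ⟨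
    (1 + a) Semiring.^ suc q                                               ≡⟨ Binomial.theorem (suc q) 1 a ⟩
    term zero + sum (λ i → term (suc i))                                   ≡⟨ cong (λ y → term zero + y) (sum-init-last (λ i → term (suc i))) ⟩
    term zero + (sum (λ i → term (suc (inject₁ i))) + term (suc (fromℕ q))) ≡⟨ cong₂ (λ x y → x + (y + term (suc (fromℕ q)))) first≡a^p middle≡w*p ⟩
    a ^ suc q + (w * suc q + term (suc (fromℕ q)))                         ≡⟨ cong (λ x → a ^ suc q + (w * suc q + x)) last≡1 ⟩
    a ^ suc q + (w * suc q + 1)                                            ≡⟨ regroup (a ^ suc q) (w * suc q) ⟩
    1 + a ^ suc q + w * suc q                                              ∎)
    where
    open ≡-Reasoning
    regroup : ∀ x y → x + (y + 1) ≡ 1 + x + y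
    regroup = solve-∀
    term : Fin (suc (suc q)) → ℕ
    term = Binomial.binomialTerm 1 a (suc q)
    middle-divisible : ∀ i → suc q ∣ term (suc (inject₁ i))
    middle-divisible i = subst (suc q ∣_) (sym (semiring-× (suc q C k) (Binomial.binomial 1 a (suc q) (suc (inject₁ i)))))
      (∣m⇒∣m*n _ (prime∣pCk pr (s≤s z≤n) (s≤s (subst (_< q) (sym (Fin.toℕ-inject₁ i)) (Fin.toℕ<n i)))))
      where
      k : ℕ
      k = suc (toℕ (inject₁ i))
    p∣middle : suc q ∣ sum (λ i → term (suc (inject₁ i)))
    p∣middle = ∣-sum (λ i → term (suc (inject₁ i))) middle-divisible
    w : ℕ
    w = quotient p∣middle
    middle≡w*p : sum (λ i → term (suc (inject₁ i))) ≡ w * suc q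
    middle≡w*p = equality p∣middle
    first≡a^p : term zero ≡ a ^ suc q
    first≡a^p = trans (ℕ.+-identityʳ _) (trans (ℕ.*-identityˡ _) (semiring-^ a (suc q)))
    last≡1 : term (suc (fromℕ q)) ≡ 1
    last≡1 rewrite Fin.toℕ-fromℕ q | nCn≡1 (suc q) | ℕ.n∸n≡0 q =
      trans (ℕ.+-identityʳ _) (trans (ℕ.*-identityʳ _) (trans (semiring-^ 1 (suc q)) (ℕ.^-zeroˡ (suc q))))

  pos-^ : ∀ n k → (+ n) ℤ.^ k ≡ + (n ^ k)
  pos-^ n zero    = refl
  pos-^ n (suc k) = trans (cong (+ n ℤ.*_) (pos-^ n k)) (sym (ℤ.pos-* n (n ^ k)))

  fermat : ∀ {p} → Prime p → ∀ a → (+ a) ℤ.^ p ≡ + a mod p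
  fermat {suc q} pr zero    = ≡-mod-reflexive (ℤ.*-zeroˡ ((+ 0) ℤ.^ q))
  fermat {p}     pr (suc a) with [1+a]^p≡1+a^p+w*p pr a
  ... | w , [1+a]^p≡ = ≡-mod-trans (≡-mod-reflexive expand) (≡-mod-trans (+-multiple-mod (+ 1 ℤ.+ + (a ^ p)) (+ w))
                         (+-cong-mod (≡-mod-refl {a = + 1}) (≡-mod-trans (≡-mod-reflexive (sym (pos-^ a p))) (fermat pr a))))
    where
    expand : (+ suc a) ℤ.^ p ≡ (+ 1 ℤ.+ + (a ^ p)) ℤ.+ + w ℤ.* + p
    expand = trans (pos-^ (suc a) p) (trans (cong +_ [1+a]^p≡) (cong (λ x → + (1 + a ^ p) ℤ.+ x) (ℤ.pos-* w p)))

  fermat-unit : ∀ {p a} → Prime p → 1 ≤ a → a < p → (+ a) ℤ.^ (p ∸ 1) ≡ + 1 mod p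
  fermat-unit {suc q} {a} pr 1≤a a<p with euclidsLemma-ℤ pr (+ a) ((+ a) ℤ.^ q ℤ.- + 1)
      (∣-respʳ-≡ (factor (+ a) ((+ a) ℤ.^ q)) (divides-difference (fermat pr a)))
    where
    factor : ∀ x y → x ℤ.* y ℤ.- x ≡ x ℤ.* (y ℤ.- + 1)
    factor = ℤ-Ring.solve-∀
  ... | inj₁ p∣a       = ⊥-elim (ℕ.<⇒≱ a<p (∣⇒≤ {{ℕ.>-nonZero 1≤a}} (∣⇒∣ᵤ p∣a)))
  ... | inj₂ p∣a^q-1   = ≡mod p∣a^q-1

module Korselt where

  open Integrality
  open Congruences
  open Polynomials
  open FermatLittle
  open import Data.Nat as ℕ using (ℕ; zero; suc; _≤_; _<_; _∸_; s≤s; z≤n)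
  import Data.Nat.Properties as ℕ
  import Data.Nat.DivMod as ℕ
  open import Data.Nat.Divisibility as ℕ using (_∣_; divides; ∣-trans; ∣-refl)
  open import Data.Nat.Coprimality as Coprimality using (Coprime; coprime-Bézout)
  open import Data.Nat.GCD using (module Bézout)
  open import Data.Nat.Primality
    using (Prime; Composite; prime⇒irreducible; prime⇒¬composite; prime⇒nonTrivial; composite⇒nonZero; ¬prime[0]; ¬prime[1])
  open import Data.Integer as ℤ using (ℤ; +_; _+_; _*_; _-_; -_; _^_)
  import Data.Integer.Properties as ℤ
  import Data.Integer.Divisibility.Signed as ℤ
  import Data.Integer.Tactic.RingSolver as ℤ-Ring
  open import Data.Nat.Tactic.RingSolver using (solve-∀)
  open import Data.Product using (Σ; _,_; proj₁; proj₂)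
  open import Data.List using (_∷_; [])
  open import Data.Sum using (inj₁; inj₂)
  open import Data.Empty using (⊥-elim)
  open import Relation.Nullary using (¬_)
  open import Relation.Binary.PropositionalEquality

  coprime-∣ : ∀ {d a u} → d ∣ a → Coprime a u → Coprime d u
  coprime-∣ d∣a coprime (i∣d , i∣u) = coprime (∣-trans i∣d d∣a , i∣u)

  coprime-* : ∀ {a u v} → Coprime a u → Coprime a v → Coprime a (u ℕ.* v)
  coprime-* coprime-u coprime-v (i∣a , i∣uv) = coprime-v (i∣a , Coprimality.coprime-divisor (coprime-∣ i∣a coprime-u) i∣uv)

  private
    cast : ∀ a b c d → 1 ℕ.+ a ℕ.* b ≡ c ℕ.* d → + 1 + + a * + b ≡ + c * + d
    cast a b c d eq = trans (cong (λ z → + 1 + z) (sym (ℤ.pos-* a b))) (trans (cong +_ eq) (ℤ.pos-* c d))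

  inverse-mod : ∀ {x p} → Coprime x p → Σ ℤ λ r → + x * r ≡ + 1 mod p
  inverse-mod {x} {p} coprime with coprime-Bézout coprime
  ... | Bézout.+- u v 1+vp≡ux = + u , ≡mod (ℤ.divides (+ v) (begin
    + x * + u - + 1        ≡⟨ cong (_- + 1) (ℤ.*-comm (+ x) (+ u)) ⟩
    + u * + x - + 1        ≡⟨ cong (_- + 1) (cast v p u x 1+vp≡ux) ⟨
    + 1 + + v * + p - + 1  ≡⟨ cancel (+ v * + p) ⟩
    + v * + p              ∎))
    where
    open ≡-Reasoning
    cancel : ∀ y → + 1 + y - + 1 ≡ y
    cancel = ℤ-Ring.solve-∀
  ... | Bézout.-+ u v 1+ux≡vp = - + u , ≡mod (ℤ.divides (- + v) (begin
    + x * - + u - + 1      ≡⟨ expand (+ x) (+ u) ⟩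
    - (+ 1 + + u * + x)    ≡⟨ cong -_ (cast u x v p 1+ux≡vp) ⟩
    - (+ v * + p)          ≡⟨ ℤ.neg-distribˡ-* (+ v) (+ p) ⟩
    - + v * + p            ∎))
    where
    open ≡-Reasoning
    expand : ∀ x u → x * - u - + 1 ≡ - (+ 1 + u * x)
    expand = ℤ-Ring.solve-∀

  [1+X]^n≡1+nX+X²Z : ∀ X n → Σ ℤ λ Z → (+ 1 + X) ^ n ≡ + 1 + + n * X + X * X * Z
  [1+X]^n≡1+nX+X²Z X zero    = + 0 , ℤ-Ring.solve (X ∷ [])
  [1+X]^n≡1+nX+X²Z X (suc n) with [1+X]^n≡1+nX+X²Z X n
  ... | Z , [1+X]^n≡ = Z + + n + X * Z , (begin
    (+ 1 + X) * (+ 1 + X) ^ n                       ≡⟨ cong ((+ 1 + X) *_) [1+X]^n≡ ⟩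
    (+ 1 + X) * (+ 1 + + n * X + X * X * Z)         ≡⟨ expand X (+ n) Z ⟩
    + 1 + (+ 1 + + n) * X + X * X * (Z + + n + X * Z) ∎)
    where
    open ≡-Reasoning
    expand : ∀ X N Z → (+ 1 + X) * (+ 1 + N * X + X * X * Z) ≡ + 1 + (+ 1 + N) * X + X * X * (Z + N + X * Z)
    expand = ℤ-Ring.solve-∀

  carmichael-mod : ∀ {m p} → Carmichael m → p ∣ m → ∀ a → Coprime ℤ.∣ a ∣ m → a ^ (m ∸ 1) ≡ + 1 mod p
  carmichael-mod {m} (_ , universal) p∣m a coprime =
    ≡mod (ℤ.∣-trans {j = + m} (ℤ.∣ᵤ⇒∣ p∣m) (ℤ.∣ᵤ⇒∣ (universal a coprime)))

  -- With a = 1 + x the Carmichael congruence reads m ∣ (m - 1) x + x² Z, and p ∣ x would give m ∣ x².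
  carmichael-squarefree : ∀ {m p x} → Carmichael m → Prime p → m ≡ x ℕ.* p → ¬ p ∣ x
  carmichael-squarefree {x = zero} (composite , _) _ m≡0 _ = ℕ.≢-nonZero⁻¹ _ {{composite⇒nonZero composite}} m≡0
  carmichael-squarefree {m} {p} {x@(suc _)} (composite , universal) pr m≡xp p∣x@(divides y x≡yp) =
    ¬prime[1] (subst Prime (ℕ.∣1⇒≡1 p∣1) pr)
    where
    coprime : Coprime (suc x) m
    coprime = subst (Coprime (suc x)) (sym m≡xp) (coprime-* 1+x⊥x 1+x⊥p)
      where
      1+x⊥x : Coprime (suc x) x
      1+x⊥x = subst (λ z → Coprime z x) (ℕ.+-comm x 1) (Coprimality.coprime-+ (Coprimality.1-coprimeTo x))
      1+x⊥p : Coprime (suc x) p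
      1+x⊥p {i} (i∣1+x , i∣p) = ℕ.∣1⇒≡1 (ℕ.∣m+n∣m⇒∣n (subst (i ∣_) (ℕ.+-comm 1 x) i∣1+x) (ℕ.∣-trans i∣p p∣x))
    Z : ℤ
    Z = proj₁ ([1+X]^n≡1+nX+X²Z (+ x) (m ∸ 1))
    m∣[m-1]x+x²Z : + m ℤ.∣ + (m ∸ 1) * + x + + x * + x * Z
    m∣[m-1]x+x²Z = subst (+ m ℤ.∣_) [1+x]^[m-1]-1≡ (ℤ.∣ᵤ⇒∣ (universal (+ suc x) coprime))
      where
      drop1 : ∀ A B → + 1 + A + B - + 1 ≡ A + B
      drop1 = ℤ-Ring.solve-∀
      [1+x]^[m-1]-1≡ : (+ suc x) ^ (m ∸ 1) - + 1 ≡ + (m ∸ 1) * + x + + x * + x * Z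
      [1+x]^[m-1]-1≡ = trans (cong (_- + 1) (proj₂ ([1+X]^n≡1+nX+X²Z (+ x) (m ∸ 1)))) (drop1 (+ (m ∸ 1) * + x) (+ x * + x * Z))
    m∣x²Z : + m ℤ.∣ + x * + x * Z
    m∣x²Z = ℤ.∣m⇒∣m*n Z (ℤ.divides (+ y) (trans (sym (ℤ.pos-* x x)) (trans (cong +_ x*x≡y*m) (ℤ.pos-* y m))))
      where
      swap : ∀ a b c → a ℕ.* (b ℕ.* c) ≡ b ℕ.* (a ℕ.* c)
      swap = solve-∀
      x*x≡y*m : x ℕ.* x ≡ y ℕ.* m
      x*x≡y*m = trans (cong (x ℕ.*_) x≡yp) (trans (swap x y p) (cong (y ℕ.*_) (sym m≡xp)))
    px∣[m-1]x : p ℕ.* x ∣ (m ∸ 1) ℕ.* x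
    px∣[m-1]x = subst₂ _∣_ (trans m≡xp (ℕ.*-comm x p)) (trans (ℤ.abs-* (+ (m ∸ 1)) (+ x)) refl)
      (ℤ.∣⇒∣ᵤ (ℤ.∣m+n∣n⇒∣m {m = + (m ∸ 1) * + x} m∣[m-1]x+x²Z m∣x²Z))
    p∣1 : p ∣ 1
    p∣1 = ℕ.∣m+n∣m⇒∣n (subst (p ∣_) (sym (ℕ.m∸n+n≡m 1≤m)) (divides x m≡xp)) (ℕ.*-cancelʳ-∣ x px∣[m-1]x)
      where
      1≤m : 1 ≤ m
      1≤m = ℕ.>-nonZero⁻¹ m {{composite⇒nonZero composite}}

  ^-mod-order : ∀ {A n d} .{{_ : ℕ.NonZero d}} → A ^ d ≡ + 1 mod n → ∀ e → A ^ e ≡ A ^ (e ℕ.% d) mod n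
  ^-mod-order {A} {n} {d} A^d≡1 e = ≡-mod-trans (≡-mod-reflexive A^e≡) (≡-mod-trans
    (*-cong-mod (≡-mod-refl {a = A ^ (e ℕ.% d)}) (≡-mod-trans (^-cong-mod (e ℕ./ d) A^d≡1) (≡-mod-reflexive (ℤ.^-zeroˡ (e ℕ./ d)))))
    (≡-mod-reflexive (ℤ.*-identityʳ (A ^ (e ℕ.% d)))))
    where
    A^e≡ : A ^ e ≡ A ^ (e ℕ.% d) * (A ^ d) ^ (e ℕ./ d)
    A^e≡ = begin
      A ^ e                              ≡⟨ cong (A ^_) (ℕ.m≡m%n+[m/n]*n e d) ⟩
      A ^ (e ℕ.% d ℕ.+ e ℕ./ d ℕ.* d)    ≡⟨ ℤ.^-distribˡ-+-* A (e ℕ.% d) (e ℕ./ d ℕ.* d) ⟩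
      A ^ (e ℕ.% d) * A ^ (e ℕ./ d ℕ.* d) ≡⟨ cong (λ k → A ^ (e ℕ.% d) * A ^ k) (ℕ.*-comm (e ℕ./ d) d) ⟩
      A ^ (e ℕ.% d) * A ^ (d ℕ.* (e ℕ./ d)) ≡⟨ cong (λ z → A ^ (e ℕ.% d) * z) (ℤ.^-*-assoc A d (e ℕ./ d)) ⟨
      A ^ (e ℕ.% d) * (A ^ d) ^ (e ℕ./ d) ∎
      where open ≡-Reasoning

  -- Lift a to a′ ≡ a (mod p) with a′ ≡ 1 (mod x); then a′ is a unit modulo m = x p.
  carmichael-units-mod-p : ∀ {m p x} → Carmichael m → Prime p → m ≡ x ℕ.* p → ¬ p ∣ x →
    ∀ {a} → 1 ≤ a → a < p → (+ a) ^ (m ∸ 1) ≡ + 1 mod p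
  carmichael-units-mod-p {m} {p} {x} C pr m≡xp p∤x {a} 1≤a a<p =
    ≡-mod-trans (^-cong-mod (m ∸ 1) (≡-mod-sym a′≡a)) (carmichael-mod C (divides x m≡xp) a′ a′⊥m)
    where
    p⊥x : Coprime p x
    p⊥x {i} (i∣p , i∣x) with prime⇒irreducible pr i∣p
    ... | inj₁ i≡1 = i≡1
    ... | inj₂ refl = ⊥-elim (p∤x i∣x)
    inverse : Σ ℤ λ r → + x * r ≡ + 1 mod p
    inverse = inverse-mod (Coprimality.sym p⊥x)
    r : ℤ
    r = proj₁ inverse
    a′ : ℤ
    a′ = + 1 + (+ x * r) * (+ a - + 1)
    a′≡a : a′ ≡ + a mod p
    a′≡a = ≡-mod-trans (+-cong-mod (≡-mod-refl {a = + 1}) (*-cong-mod (proj₂ inverse) ≡-mod-refl))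
                       (≡-mod-reflexive (cancel (+ a)))
      where
      cancel : ∀ A → + 1 + + 1 * (A - + 1) ≡ A
      cancel = ℤ-Ring.solve-∀
    a′⊥m : Coprime ℤ.∣ a′ ∣ m
    a′⊥m = subst (Coprime ℤ.∣ a′ ∣) (sym m≡xp) (coprime-* a′⊥x a′⊥p)
      where
      a′⊥x : Coprime ℤ.∣ a′ ∣ x
      a′⊥x {i} (i∣a′ , i∣x) = ℕ.∣1⇒≡1 (ℤ.∣⇒∣ᵤ (ℤ.∣m+n∣n⇒∣m {m = + 1} (ℤ.∣ᵤ⇒∣ i∣a′)
        (ℤ.∣m⇒∣m*n (+ a - + 1) (ℤ.∣m⇒∣m*n {+ i} {+ x} r (ℤ.∣ᵤ⇒∣ i∣x)))))
      a′⊥p : Coprime ℤ.∣ a′ ∣ p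
      a′⊥p {i} (i∣a′ , i∣p) with prime⇒irreducible pr i∣p
      ... | inj₁ i≡1 = i≡1
      ... | inj₂ refl = ⊥-elim (ℕ.<⇒≱ a<p (ℕ.∣⇒≤ {{ℕ.>-nonZero 1≤a}} (ℤ.∣⇒∣ᵤ p∣a)))
        where
        a′≡0 : a′ ≡ + 0 mod p
        a′≡0 = ≡mod (∣-respʳ-≡ (sym (ℤ.+-identityʳ a′)) (ℤ.∣ᵤ⇒∣ i∣a′))
        p∣a : + p ℤ.∣ + a
        p∣a = ∣-respʳ-≡ (ℤ.+-identityʳ (+ a)) (divides-difference (≡-mod-trans (≡-mod-sym a′≡a) a′≡0))

  carmichael-[p∸1]∣[m∸1] : ∀ {m p x} → Carmichael m → Prime p → m ≡ x ℕ.* p → (p ∸ 1) ∣ (m ∸ 1)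
  carmichael-[p∸1]∣[m∸1] {p = 0} _ pr _ = ⊥-elim (¬prime[0] pr)
  carmichael-[p∸1]∣[m∸1] {p = 1} _ pr _ = ⊥-elim (¬prime[1] pr)
  carmichael-[p∸1]∣[m∸1] {m} {p@(suc (suc _))} {x} C pr m≡xp with (m ∸ 1) ℕ.% (p ∸ 1) in r≡ | ℕ.m≡m%n+[m/n]*n (m ∸ 1) (p ∸ 1)
  ... | zero  | m∸1≡ = divides ((m ∸ 1) ℕ./ (p ∸ 1)) m∸1≡
  ... | suc r | _    = ⊥-elim (¬all-roots-of-unity pr (s≤s z≤n) r<p∸1 roots)
    where
    r<p∸1 : suc r < p ∸ 1
    r<p∸1 = subst (_< p ∸ 1) r≡ (ℕ.m%n<n (m ∸ 1) (p ∸ 1))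
    roots : ∀ a → 1 ≤ a → a < p → (+ a) ^ suc r ≡ + 1 mod p
    roots a 1≤a a<p = subst (λ e → (+ a) ^ e ≡ + 1 mod p) r≡
      (≡-mod-trans (≡-mod-sym (^-mod-order (fermat-unit pr 1≤a a<p) (m ∸ 1)))
                   (carmichael-units-mod-p C pr m≡xp (carmichael-squarefree {x = x} C pr m≡xp) 1≤a a<p))

  evenIntAtLeast6-carmichael : ∀ {g m} → Carmichael m → Prime g → g ∣ m → EvenIntAtLeast (+ 6) (hVal g m)
  evenIntAtLeast6-carmichael {g} C@(composite , _) pr (divides x refl) =
    evenIntAtLeast6-x*g 2≤g (2≤x x composite) x≢g (carmichael-[p∸1]∣[m∸1] {x = x} C pr refl)
    where
    2≤g : 2 ≤ g
    2≤g = ℕ.nonTrivial⇒n>1 g {{prime⇒nonTrivial pr}}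
    2≤x : ∀ x → Composite (x ℕ.* g) → 2 ≤ x
    2≤x 0             composite = ⊥-elim (ℕ.≢-nonZero⁻¹ 0 {{composite⇒nonZero composite}} refl)
    2≤x 1             composite = ⊥-elim (prime⇒¬composite pr (subst Composite (ℕ.*-identityˡ g) composite))
    2≤x (suc (suc _)) _         = s≤s (s≤s z≤n)
    x≢g : x ≢ g
    x≢g refl = carmichael-squarefree C pr refl ∣-refl

open Parameter using (hVal-positive; ½[g²[h-2]-g[h-4]]≡m)
open Integrality using (hVal≡ℤtoℚ⇒1≤H; hVal≡ℤtoℚ⇒polygonal; m≡g⇔hVal≡2; g≡2⇔hVal≡m; evenIntAtLeast4-∣)
open DigitSums using (evenIntAtLeast6-digitSum)
open Factors using (evenIntAtLeast6-sDecomp; evenIntAtLeast4-universalForm)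
open Korselt using (evenIntAtLeast6-carmichael)

open import Data.Nat using (ℕ; _≤_; _<_; _∸_)
open import Data.Nat.Divisibility using (_∣_)
open import Data.Nat.Primality using (Prime)
open import Data.Integer using (ℤ; +_)
open import Data.Rational using (ℚ; 0ℚ; ½; _*_; _-_; _/_)
import Data.Rational as Q
open import Data.List using (List; map)
open import Data.List.Membership.Propositional using (_∈_)
open import Data.Fin using (Fin)
open import Data.Product using (_×_; Σ; proj₁; _,_)
open import Function.Bundles using (_⇔_)
open import Relation.Binary.PropositionalEquality using (_≡_)

theorem10p3 :
    (∀ (g m : ℕ) → 2 ≤ g → 1 ≤ m →
      -- h > 0
      (0ℚ Q.< hVal g m)
      -- ½ (g²(h-2) - g(h-4)) = m
      × (½ * (((+ g / 1) * (+ g / 1)) * (hVal g m - (+ 2 / 1))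
               - (+ g / 1) * (hVal g m - (+ 4 / 1))) ≡ + m / 1)
      -- whenever h is an integer H: H ≥ 1 and m = P^H_g
      × (∀ (H : ℤ) → hVal g m ≡ ℤtoℚ H → (+ 1 Data.Integer.≤ H) × (+ m ≡ Polygonal H g))
      -- (i)
      × ((m ≡ g) ⇔ (hVal g m ≡ + 2 / 1))
      × ((g ≡ 2) ⇔ (hVal g m ≡ + m / 1))
      -- (ii)
      × (g < m → g ∣ m → (g ∸ 1) ∣ (m ∸ 1) → EvenIntAtLeast (+ 4) (hVal g m))
      -- (iii)
      × (g ∣ m → digitSum g m ≡ g → EvenIntAtLeast (+ 6) (hVal g m))
      -- (iv)
      × (InS m → (Σ (List (ℕ × ℕ)) λ d → StrictSDecomp m d × (g ∈ map proj₁ d))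
           → EvenIntAtLeast (+ 6) (hVal g m))
      -- (v)
      × (Carmichael m → Prime g → g ∣ m → EvenIntAtLeast (+ 6) (hVal g m)))
    -- (vi)
    × (∀ (n : ℕ) (a b : Fin n → ℕ) → UniversalForm n a b →
         ∀ (ν : Fin n) (t : ℕ) →
           linFactor a b ν t < Uform a b t → 1 < linFactor a b ν t →
           EvenIntAtLeast (+ 4) (hVal (linFactor a b ν t) (Uform a b t)))
theorem10p3 =
    (λ g m 2≤g 1≤m →
        hVal-positive 2≤g 1≤m
      , ½[g²[h-2]-g[h-4]]≡m m 2≤g
      , (λ H h≡H → hVal≡ℤtoℚ⇒1≤H H 2≤g 1≤m h≡H , hVal≡ℤtoℚ⇒polygonal H 2≤g h≡H)
      , m≡g⇔hVal≡2 m 2≤g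
      , g≡2⇔hVal≡m m 2≤g 1≤m
      , evenIntAtLeast4-∣ 2≤g
      , evenIntAtLeast6-digitSum 2≤g
      , (λ _ (_ , decomposition , g∈d) → evenIntAtLeast6-sDecomp 2≤g decomposition g∈d)
      , evenIntAtLeast6-carmichael)
  , (λ _ _ _ → evenIntAtLeast4-universalForm)
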